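{- Let $G$ and $H$ be complete multipartite graphs. Then \[\alpha(G \times H) = \kappa(G \times H)= \max\{\alpha(G)\cdot |V(H)|,\ \alpha(H)\cdot |V(G)|\}.\]
   Context: For graphs $G$ and $H$, the categorical (tensor) product $G \times H$ has vertex set $V(G)\times V(H)$, and $(g_1,h_1)$ is adjacent to $(g_2,h_2)$ iff $\{g_1,g_2\}\in E(G)$ and $\{h_1,h_2\}\in E(H)$. A complete multipartite graph is a graph whose vertex set is partitioned into independent sets such that any two vertices in different parts are adjacent. $\alpha(\cdot)$ denotes the independence number and $\kappa(\cdot)$ the clique cover number (minimum number of cliques whose union is the vertex set). -}

module Defs where

open import Data.Nat using (ℕ; _*_; _≤_)
open import Data.Fin using (Fin; remQuot)
open import Data.Fin.Subset using (Subset; _∈_; ∣_∣)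
open import Data.Product using (Σ; ∃; _×_; _,_; proj₁; proj₂)
open import Relation.Nullary using (¬_)
open import Relation.Binary.PropositionalEquality using (_≡_; _≢_; refl)
open import Function.Bundles using (_⇔_)

record Graph (n : ℕ) : Set₁ where
  field
    Adj     : Fin n → Fin n → Set
    sym     : ∀ {u v} → Adj u v → Adj v u
    irrefl  : ∀ {u} → ¬ Adj u u
open Graph public

∣V∣ : ∀ {n} → Graph n → ℕ
∣V∣ {n} _ = n

-- Categorical (tensor) product; V(G × H) = Fin n × Fin m encoded as Fin (n * m)
-- via Data.Fin.remQuot (a bijection Fin (n * m) ≅ Fin n × Fin m).
fstV : ∀ {n} m → Fin (n * m) → Fin n
fstV {n} m x = proj₁ (remQuot {n} m x)

sndV : ∀ {n} m → Fin (n * m) → Fin m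
sndV {n} m x = proj₂ (remQuot {n} m x)

_⊗_ : ∀ {n m} → Graph n → Graph m → Graph (n * m)
_⊗_ {n} {m} G H = record
  { Adj    = λ x y → Adj G (fstV {n} m x) (fstV {n} m y)
                   × Adj H (sndV {n} m x) (sndV {n} m y)
  ; sym    = λ { (a , b) → sym G a , sym H b }
  ; irrefl = λ { (a , b) → irrefl G a }
  }

IsCompleteMultipartite : ∀ {n} → Graph n → Set
IsCompleteMultipartite {n} G =
  Σ ℕ λ k → Σ (Fin n → Fin k) λ part →
    ∀ u v → Adj G u v ⇔ (part u ≢ part v)

IsIndependent : ∀ {n} → Graph n → Subset n → Set
IsIndependent G S = ∀ u v → u ∈ S → v ∈ S → ¬ Adj G u v

IsClique : ∀ {n} → Graph n → Subset n → Set
IsClique G S = ∀ u v → u ∈ S → v ∈ S → u ≢ v → Adj G u v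

CliqueCover : ∀ {n} → Graph n → ℕ → Set
CliqueCover {n} G k =
  Σ (Fin k → Subset n) λ C → (∀ i → IsClique G (C i)) × (∀ v → ∃ λ i → v ∈ C i)

IsIndependenceNumber : ∀ {n} → Graph n → ℕ → Set
IsIndependenceNumber G a =
  (Σ _ λ S → IsIndependent G S × ∣ S ∣ ≡ a) ×
  (∀ S → IsIndependent G S → ∣ S ∣ ≤ a)

IsCliqueCoverNumber : ∀ {n} → Graph n → ℕ → Set
IsCliqueCoverNumber G c = CliqueCover G c × (∀ k → CliqueCover G k → c ≤ k)

module Submission where

-- In every graph an independent set meets each clique of a cover at most once, so α ≤ κ; it thus
-- suffices to exhibit an independent set and a clique cover of the same size D = max(α(G)·|V(H)|,
-- α(H)·|V(G)|). An independent set of G times V(H), or V(G) times one of H, has size D. For the cover,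
-- number V(G) class by class, so that every class is an interval, and likewise V(H); a vertex (x, y)
-- of G × H gets as colour, modulo D, its position inside the block (class of x) × (class of y), shifted
-- by α(H)·(start of the class of x) and by α(G)·(start of the class of y). Two vertices with a common
-- G-class then differ in colour, as their H-shifted positions are distinct numbers below α(G)·|V(H)| ≤ D,
-- and symmetrically; so every colour class is a clique.

open import Defs hiding (sym)
open import Data.Bool using (Bool; true; false; if_then_else_)
open import Data.Fin as Fin using (Fin; zero; suc; toℕ; fromℕ<; _↑ˡ_; _↑ʳ_; combine)
import Data.Fin.Properties as Finₚ
open import Data.Fin.Subset using (Subset; ∣_∣; _∈_; _∉_; _⊆_; _∩_; _∪_; _-_; ⊤; ⁅_⁆; Empty)
open import Data.Fin.Subset.Properties
  using ( p⊆q⇒∣p∣≤∣q∣; p⊂q⇒∣p∣<∣q∣; x∈p⇒∣p-x∣<∣p∣; x∈p∧x≢y⇒x∈p-y; x∈p∪q⁻; x∈p∩q⁺; x∈p∩q⁻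
        ; drop-∷-Empty; ∈⊤; ∣⊤∣≡n; x∈⁅x⁆; x∈⁅y⁆⇒x≡y)
open import Data.Nat using (ℕ; zero; suc; _+_; _*_; _⊔_; _≤_; _<_; z≤n; s≤s; NonZero; >-nonZero; _%_; _/_)
open import Data.Nat.DivMod using (m≡m%n+[m/n]*n; [m+kn]%n≡m%n; m<n⇒m%n≡m; m%n<n)
open import Data.Nat.Properties
open import Algebra.Properties.CommutativeSemigroup +-commutativeSemigroup using (x∙yz≈y∙xz; xy∙z≈xz∙y)
open import Data.Product using (Σ; _×_; _,_; proj₁; proj₂)
open import Data.Sum using ([_,_]; inj₁; inj₂)
open import Data.Vec using ([]; _∷_; here; there; tabulate; lookup)
open import Data.Vec.Properties using (lookup∘tabulate; tabulate∘lookup; tabulate-cong; []=⇒lookup; lookup⇒[]=)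
open import Function using (_∘_)
open import Function.Bundles using (_⇔_; Equivalence)
open import Relation.Binary.Definitions using (tri<; tri≈; tri>)
open import Relation.Binary.PropositionalEquality hiding ([_])
open import Relation.Nullary using (does; proof; contradiction)
open import Relation.Nullary.Decidable using (dec-true; decidable-stable)
open import Relation.Nullary.Reflects using (Reflects; invert)

preimage : ∀ {n k} → (Fin n → Fin k) → Subset k → Subset n
preimage f p = tabulate (lookup p ∘ f)

module _ {n k} {f : Fin n → Fin k} {p : Subset k} {x : Fin n} where

  ∈-preimage⁺ : f x ∈ p → x ∈ preimage f p
  ∈-preimage⁺ fx∈p = lookup⇒[]= x _ (trans (lookup∘tabulate (lookup p ∘ f) x) ([]=⇒lookup fx∈p))

  ∈-preimage⁻ : x ∈ preimage f p → f x ∈ p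
  ∈-preimage⁻ x∈ = lookup⇒[]= (f x) p (trans (sym (lookup∘tabulate (lookup p ∘ f) x)) ([]=⇒lookup x∈))

below : ∀ {n} → Fin n → Subset n
below i = tabulate (λ j → does (j Fin.<? i))

module _ {n} {i j : Fin n} where

  ∈-below⁺ : j Fin.< i → j ∈ below i
  ∈-below⁺ j<i = lookup⇒[]= j _ (trans (lookup∘tabulate _ j) (dec-true (j Fin.<? i) j<i))

  ∈-below⁻ : j ∈ below i → j Fin.< i
  ∈-below⁻ j∈ = invert (subst (Reflects _) does≡true (proof (j Fin.<? i)))
    where does≡true = trans (sym (lookup∘tabulate (λ j → does (j Fin.<? i)) j)) ([]=⇒lookup j∈)

i∉below-i : ∀ {n} (i : Fin n) → i ∉ below i
i∉below-i i = Finₚ.<-irrefl refl ∘ ∈-below⁻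

∣p∪q∣≡∣p∣+∣q∣ : ∀ {n} (p q : Subset n) → Empty (p ∩ q) → ∣ p ∪ q ∣ ≡ ∣ p ∣ + ∣ q ∣
∣p∪q∣≡∣p∣+∣q∣ []          []          _        = refl
∣p∪q∣≡∣p∣+∣q∣ (true  ∷ p) (true  ∷ q) disjoint = contradiction (zero , here) disjoint
∣p∪q∣≡∣p∣+∣q∣ (true  ∷ p) (false ∷ q) disjoint = cong suc (∣p∪q∣≡∣p∣+∣q∣ p q (drop-∷-Empty disjoint))
∣p∪q∣≡∣p∣+∣q∣ (false ∷ p) (true  ∷ q) disjoint =
  trans (cong suc (∣p∪q∣≡∣p∣+∣q∣ p q (drop-∷-Empty disjoint))) (sym (+-suc ∣ p ∣ ∣ q ∣))
∣p∪q∣≡∣p∣+∣q∣ (false ∷ p) (false ∷ q) disjoint = ∣p∪q∣≡∣p∣+∣q∣ p q (drop-∷-Empty disjoint)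

∣p∣+∣q∣≤∣r∣ : ∀ {n} {p q r : Subset n} → Empty (p ∩ q) → p ⊆ r → q ⊆ r → ∣ p ∣ + ∣ q ∣ ≤ ∣ r ∣
∣p∣+∣q∣≤∣r∣ {p = p} {q} disjoint p⊆r q⊆r = begin
  ∣ p ∣ + ∣ q ∣ ≡⟨ ∣p∪q∣≡∣p∣+∣q∣ p q disjoint ⟨
  ∣ p ∪ q ∣     ≤⟨ p⊆q⇒∣p∣≤∣q∣ (λ x∈ → [ p⊆r , q⊆r ] (x∈p∪q⁻ p q x∈)) ⟩
  _             ∎
  where open ≤-Reasoning

injectiveOn⇒∣p∣≤∣q∣ : ∀ {n k} (p : Subset n) {q : Subset k} (f : Fin n → Fin k) →
                      (∀ {x} → x ∈ p → f x ∈ q) →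
                      (∀ {x y} → x ∈ p → y ∈ p → f x ≡ f y → x ≡ y) →
                      ∣ p ∣ ≤ ∣ q ∣
injectiveOn⇒∣p∣≤∣q∣ []          f _    _   = z≤n
injectiveOn⇒∣p∣≤∣q∣ (false ∷ p) f into inj =
  injectiveOn⇒∣p∣≤∣q∣ p (f ∘ suc) (into ∘ there) (λ x∈ y∈ → Finₚ.suc-injective ∘ inj (there x∈) (there y∈))
injectiveOn⇒∣p∣≤∣q∣ (true  ∷ p) {q} f into inj =
  ≤-trans (s≤s (injectiveOn⇒∣p∣≤∣q∣ p (f ∘ suc) into′ (λ x∈ y∈ → Finₚ.suc-injective ∘ inj (there x∈) (there y∈))))
          (x∈p⇒∣p-x∣<∣p∣ (into here))
  where
  into′ : ∀ {x} → x ∈ p → f (suc x) ∈ q - f zero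
  into′ x∈ = x∈p∧x≢y⇒x∈p-y (into (there x∈)) (Finₚ.0≢1+n ∘ sym ∘ inj (there x∈) here)

∣tabulate∣-↑ : ∀ m {k} (f : Fin (m + k) → Bool) →
               ∣ tabulate f ∣ ≡ ∣ tabulate (f ∘ (_↑ˡ k)) ∣ + ∣ tabulate (f ∘ (m ↑ʳ_)) ∣
∣tabulate∣-↑ zero    f = refl
∣tabulate∣-↑ (suc m) f with f zero
... | true  = cong suc (∣tabulate∣-↑ m (f ∘ suc))
... | false = ∣tabulate∣-↑ m (f ∘ suc)

∣tabulate-const∣ : ∀ m b → ∣ tabulate {m} (λ _ → b) ∣ ≡ (if b then m else 0)
∣tabulate-const∣ zero    true  = refl
∣tabulate-const∣ zero    false = refl
∣tabulate-const∣ (suc m) true  = cong suc (∣tabulate-const∣ m true)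
∣tabulate-const∣ (suc m) false = ∣tabulate-const∣ m false

∣tabulate∣-combineˡ : ∀ n {m} (f : Fin (n * m) → Bool) (g : Fin n → Bool) →
                      (∀ x y → f (combine x y) ≡ g x) → ∣ tabulate f ∣ ≡ ∣ tabulate g ∣ * m
∣tabulate∣-combineˡ zero    f g _   = refl
∣tabulate∣-combineˡ (suc n) {m} f g f≗g = begin
  ∣ tabulate f ∣
    ≡⟨ ∣tabulate∣-↑ m f ⟩
  ∣ tabulate (f ∘ (_↑ˡ (n * m))) ∣ + ∣ tabulate (f ∘ (m ↑ʳ_)) ∣
    ≡⟨ cong₂ _+_ (trans (cong ∣_∣ (tabulate-cong (f≗g zero))) (∣tabulate-const∣ m (g zero)))
                 (∣tabulate∣-combineˡ n {m} (f ∘ (m ↑ʳ_)) (g ∘ suc) (f≗g ∘ suc)) ⟩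
  (if g zero then m else 0) + ∣ tabulate (g ∘ suc) ∣ * m
    ≡⟨ first-row (g zero) ⟩
  ∣ tabulate g ∣ * m ∎
  where
  open ≡-Reasoning
  first-row : ∀ b → (if b then m else 0) + ∣ tabulate (g ∘ suc) ∣ * m ≡ ∣ b ∷ tabulate (g ∘ suc) ∣ * m
  first-row true  = refl
  first-row false = refl

∣tabulate∣-combineʳ : ∀ n {m} (f : Fin (n * m) → Bool) (g : Fin m → Bool) →
                      (∀ (x : Fin n) y → f (combine x y) ≡ g y) → ∣ tabulate f ∣ ≡ n * ∣ tabulate g ∣
∣tabulate∣-combineʳ zero    f g _   = refl
∣tabulate∣-combineʳ (suc n) {m} f g f≗g =
  trans (∣tabulate∣-↑ m f)
        (cong₂ _+_ (cong ∣_∣ (tabulate-cong (f≗g zero)))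
                   (∣tabulate∣-combineʳ n {m} (f ∘ (m ↑ʳ_)) g (f≗g ∘ suc)))

∣preimage-fstV∣ : ∀ {n} m (p : Subset n) → ∣ preimage (fstV {n} m) p ∣ ≡ ∣ p ∣ * m
∣preimage-fstV∣ {n} m p =
  trans (∣tabulate∣-combineˡ n {m} _ (lookup p) (λ x y → cong (lookup p ∘ proj₁) (Finₚ.remQuot-combine x y)))
        (cong (λ q → ∣ q ∣ * m) (tabulate∘lookup p))

∣preimage-sndV∣ : ∀ {n} m (p : Subset m) → ∣ preimage (sndV {n} m) p ∣ ≡ n * ∣ p ∣
∣preimage-sndV∣ {n} m p =
  trans (∣tabulate∣-combineʳ n {m} _ (lookup p) (λ x y → cong (lookup p ∘ proj₂) (Finₚ.remQuot-combine x y)))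
        (cong (λ q → n * ∣ q ∣) (tabulate∘lookup p))

+-*-unique : ∀ {s t t′} r r′ → t < s → t′ < s → t + r * s ≡ t′ + r′ * s → t ≡ t′ × r ≡ r′
+-*-unique {s} {t} {t′} r r′ t<s t′<s eq =
  t≡t′ , *-cancelʳ-≡ r r′ s (+-cancelˡ-≡ t _ _ (trans eq (cong (_+ r′ * s) (sym t≡t′))))
  where
  instance
    s≢0 : NonZero s
    s≢0 = >-nonZero (≤-<-trans z≤n t<s)
  t≡t′ : t ≡ t′
  t≡t′ = begin
    t               ≡⟨ m<n⇒m%n≡m t<s ⟨
    t % s           ≡⟨ [m+kn]%n≡m%n t r s ⟨
    (t + r * s) % s ≡⟨ cong (_% s) eq ⟩
    (t′ + r′ * s) % s ≡⟨ [m+kn]%n≡m%n t′ r′ s ⟩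
    t′ % s          ≡⟨ m<n⇒m%n≡m t′<s ⟩
    t′              ∎
    where open ≡-Reasoning

+-cancelˡ-% : ∀ c {w w′ d} .{{_ : NonZero d}} → w < d → w′ < d → (c + w) % d ≡ (c + w′) % d → w ≡ w′
+-cancelˡ-% c {w} {w′} {d} w<d w′<d eq = proj₁ (+-*-unique q′ q w<d w′<d (+-cancelˡ-≡ c _ _ (begin
  c + (w + q′ * d)                ≡⟨ +-assoc c w _ ⟨
  c + w + q′ * d                  ≡⟨ cong (_+ q′ * d) (m≡m%n+[m/n]*n (c + w) d) ⟩
  (c + w) % d + q * d + q′ * d    ≡⟨ xy∙z≈xz∙y ((c + w) % d) _ _ ⟩
  (c + w) % d + q′ * d + q * d    ≡⟨ cong (λ r → r + q′ * d + q * d) eq ⟩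
  (c + w′) % d + q′ * d + q * d   ≡⟨ cong (_+ q * d) (m≡m%n+[m/n]*n (c + w′) d) ⟨
  c + w′ + q * d                  ≡⟨ +-assoc c w′ _ ⟩
  c + (w′ + q * d)                ∎)))
  where
  open ≡-Reasoning
  q q′ : ℕ
  q  = (c + w) / d
  q′ = (c + w′) / d

module _ {n} (G : Graph n) where

  ∣independent∣≤cliqueCover : ∀ {S k} → IsIndependent G S → CliqueCover G k → ∣ S ∣ ≤ k
  ∣independent∣≤cliqueCover {S} {k} S-indep (C , C-clique , C-covers) = begin
    ∣ S ∣     ≤⟨ injectiveOn⇒∣p∣≤∣q∣ S cliqueOf (λ _ → ∈⊤) cliqueOf-injective ⟩
    ∣ ⊤ {k} ∣ ≡⟨ ∣⊤∣≡n k ⟩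
    k         ∎
    where
    open ≤-Reasoning
    cliqueOf : Fin n → Fin k
    cliqueOf u = proj₁ (C-covers u)
    cliqueOf-injective : ∀ {u v} → u ∈ S → v ∈ S → cliqueOf u ≡ cliqueOf v → u ≡ v
    cliqueOf-injective {u} {v} u∈S v∈S same = decidable-stable (u Finₚ.≟ v) λ u≢v →
      S-indep u v u∈S v∈S
        (C-clique (cliqueOf v) u v (subst (λ i → u ∈ C i) same (proj₂ (C-covers u))) (proj₂ (C-covers v)) u≢v)

  independent+cliqueCover⇒numbers : ∀ {d} → (Σ (Subset n) λ S → IsIndependent G S × ∣ S ∣ ≡ d) →
                                    CliqueCover G d → IsIndependenceNumber G d × IsCliqueCoverNumber G d
  independent+cliqueCover⇒numbers S@(_ , S-indep , ∣S∣≡d) cover =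
    (S , λ T T-indep → ∣independent∣≤cliqueCover T-indep cover) ,
    (cover , λ k cover′ → subst (_≤ k) ∣S∣≡d (∣independent∣≤cliqueCover S-indep cover′))

module _ {n m} (G : Graph n) (H : Graph m) where

  preimage-fstV-independent : ∀ {S} → IsIndependent G S → IsIndependent (G ⊗ H) (preimage (fstV m) S)
  preimage-fstV-independent S-indep u v u∈ v∈ (adj , _) = S-indep _ _ (∈-preimage⁻ u∈) (∈-preimage⁻ v∈) adj

  preimage-sndV-independent : ∀ {S} → IsIndependent H S → IsIndependent (G ⊗ H) (preimage (sndV {n} m) S)
  preimage-sndV-independent S-indep u v u∈ v∈ (_ , adj) = S-indep _ _ (∈-preimage⁻ u∈) (∈-preimage⁻ v∈) adj

  ⊗-independent-⊔ : ∀ {a b} → IsIndependenceNumber G a → IsIndependenceNumber H b →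
                    Σ (Subset (n * m)) λ S → IsIndependent (G ⊗ H) S × ∣ S ∣ ≡ a * m ⊔ b * n
  ⊗-independent-⊔ {a} {b} ((S , S-indep , ∣S∣≡a) , _) ((T , T-indep , ∣T∣≡b) , _) with ⊔-sel (a * m) (b * n)
  ... | inj₁ ⊔≡am = preimage (fstV m) S , preimage-fstV-independent S-indep ,
                    trans (∣preimage-fstV∣ m S) (trans (cong (_* m) ∣S∣≡a) (sym ⊔≡am))
  ... | inj₂ ⊔≡bn = preimage (sndV {n} m) T , preimage-sndV-independent T-indep ,
                    trans (∣preimage-sndV∣ {n} m T) (trans (trans (cong (n *_) ∣T∣≡b) (*-comm n b)) (sym ⊔≡bn))

-- Numbering the vertices class by class, in the order of the class indices and then of the vertices,
-- class i occupies the interval [offset i, offset i + size i) and x gets the number offset (part x) + rank x.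
module Layout {n k} (part : Fin n → Fin k) where

  class : Fin k → Subset n
  class i = preimage part ⁅ i ⁆

  offset size : Fin k → ℕ
  offset i = ∣ preimage part (below i) ∣
  size   i = ∣ class i ∣

  earlier : Fin n → Subset n
  earlier x = below x ∩ class (part x)

  rank : Fin n → ℕ
  rank x = ∣ earlier x ∣

  ∈-class⁺ : ∀ x → x ∈ class (part x)
  ∈-class⁺ x = ∈-preimage⁺ (x∈⁅x⁆ (part x))

  ∈-class⁻ : ∀ {x} i → x ∈ class i → part x ≡ i
  ∈-class⁻ i = x∈⁅y⁆⇒x≡y i ∘ ∈-preimage⁻

  x∉earlier : ∀ x → x ∉ earlier x
  x∉earlier x = i∉below-i x ∘ proj₁ ∘ x∈p∩q⁻ _ _

  rank<size : ∀ x → rank x < size (part x)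
  rank<size x = p⊂q⇒∣p∣<∣q∣ (proj₂ ∘ x∈p∩q⁻ _ _ , x , ∈-class⁺ x , x∉earlier x)

  rank-mono : ∀ {x y} → part x ≡ part y → x Fin.< y → rank x < rank y
  rank-mono {x} {y} px≡py x<y = p⊂q⇒∣p∣<∣q∣ (earlier-x⊆earlier-y , x , x∈earlier-y , x∉earlier x)
    where
    x∈earlier-y : x ∈ earlier y
    x∈earlier-y = x∈p∩q⁺ (∈-below⁺ x<y , subst (λ i → x ∈ class i) px≡py (∈-class⁺ x))
    earlier-x⊆earlier-y : earlier x ⊆ earlier y
    earlier-x⊆earlier-y z∈ with z<x , z∈class ← x∈p∩q⁻ _ _ z∈ =
      x∈p∩q⁺ (∈-below⁺ (Finₚ.<-trans (∈-below⁻ z<x) x<y) , subst (λ i → _ ∈ class i) px≡py z∈class)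

  rank-injective : ∀ {x y} → part x ≡ part y → rank x ≡ rank y → x ≡ y
  rank-injective {x} {y} px≡py rx≡ry with Finₚ.<-cmp x y
  ... | tri< x<y _ _ = contradiction rx≡ry (<⇒≢ (rank-mono px≡py x<y))
  ... | tri≈ _ x≡y _ = x≡y
  ... | tri> _ _ y<x = contradiction (sym rx≡ry) (<⇒≢ (rank-mono (sym px≡py) y<x))

  below-class-disjoint : ∀ i → Empty (preimage part (below i) ∩ class i)
  below-class-disjoint i (x , x∈) with x∈below , x∈class ← x∈p∩q⁻ _ _ x∈ =
    Finₚ.<-irrefl (∈-class⁻ i x∈class) (∈-below⁻ (∈-preimage⁻ x∈below))

  offset+size≤n : ∀ i → offset i + size i ≤ n
  offset+size≤n i =
    subst (offset i + size i ≤_) (∣⊤∣≡n n) (∣p∣+∣q∣≤∣r∣ (below-class-disjoint i) (λ _ → ∈⊤) (λ _ → ∈⊤))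

  offset+size≤offset : ∀ {i j} → i Fin.< j → offset i + size i ≤ offset j
  offset+size≤offset {i} {j} i<j = ∣p∣+∣q∣≤∣r∣ (below-class-disjoint i)
    (λ x∈ → ∈-preimage⁺ (∈-below⁺ (Finₚ.<-trans (∈-below⁻ (∈-preimage⁻ x∈)) i<j)))
    (λ x∈ → ∈-preimage⁺ (∈-below⁺ (subst (Fin._< j) (sym (∈-class⁻ _ x∈)) i<j)))

  module _ (c : ℕ) where

    block<end : ∀ {i e} → e < c * size i → c * offset i + e < c * (offset i + size i)
    block<end {i} {e} e< = begin-strict
      c * offset i + e          <⟨ +-monoʳ-< (c * offset i) e< ⟩
      c * offset i + c * size i ≡⟨ *-distribˡ-+ c (offset i) (size i) ⟨
      c * (offset i + size i)   ∎
      where open ≤-Reasoning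

    block<n : ∀ {i e} → e < c * size i → c * offset i + e < c * n
    block<n {i} e< = <-≤-trans (block<end {i} e<) (*-monoʳ-≤ c (offset+size≤n i))

    block-< : ∀ {i j e} e′ → i Fin.< j → e < c * size i → c * offset i + e < c * offset j + e′
    block-< {i} e′ i<j e< =
      <-≤-trans (block<end {i} e<) (≤-trans (*-monoʳ-≤ c (offset+size≤offset i<j)) (m≤m+n _ e′))

    block-injective : ∀ {i j e e′} → e < c * size i → e′ < c * size j →
                      c * offset i + e ≡ c * offset j + e′ → i ≡ j
    block-injective {i} {j} {e} {e′} e< e′< eq with Finₚ.<-cmp i j
    ... | tri< i<j _ _ = contradiction eq (<⇒≢ (block-< {i} e′ i<j e<))
    ... | tri≈ _ i≡j _ = i≡j
    ... | tri> _ _ j<i = contradiction (sym eq) (<⇒≢ (block-< {j} e j<i e′<))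

fstV-sndV-injective : ∀ {n} m {u v : Fin (n * m)} →
                      fstV {n} m u ≡ fstV {n} m v → sndV {n} m u ≡ sndV {n} m v → u ≡ v
fstV-sndV-injective {n} m {u} {v} fst≡ snd≡ = begin
  u                                     ≡⟨ Finₚ.combine-remQuot {n} m u ⟨
  combine (fstV {n} m u) (sndV {n} m u) ≡⟨ cong₂ combine fst≡ snd≡ ⟩
  combine (fstV {n} m v) (sndV {n} m v) ≡⟨ Finₚ.combine-remQuot {n} m v ⟩
  v                                     ∎
  where open ≡-Reasoning

class-independent : ∀ {n k} (G : Graph n) (part : Fin n → Fin k) →
                    (∀ u v → Adj G u v ⇔ (part u ≢ part v)) → ∀ i → IsIndependent G (Layout.class part i)
class-independent G part multipartite i u v u∈ v∈ adj =
  Equivalence.to (multipartite u v) adj (trans (∈-class⁻ i u∈) (sym (∈-class⁻ i v∈)))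
  where open Layout part

module ⊗-CliqueCover
  {n m} (G : Graph n) (H : Graph m)
  {k} (partG : Fin n → Fin k) (G-multipartite : ∀ u v → Adj G u v ⇔ (partG u ≢ partG v))
  {l} (partH : Fin m → Fin l) (H-multipartite : ∀ u v → Adj H u v ⇔ (partH u ≢ partH v))
  {a b} (αG≤a : ∀ S → IsIndependent G S → ∣ S ∣ ≤ a) (αH≤b : ∀ S → IsIndependent H S → ∣ S ∣ ≤ b)
  where

  module LG = Layout partG
  module LH = Layout partH

  D : ℕ
  D = a * m ⊔ b * n

  π₁ : Fin (n * m) → Fin n
  π₁ = fstV m

  π₂ : Fin (n * m) → Fin m
  π₂ = sndV {n} m

  classG : Fin (n * m) → Fin k
  classG u = partG (π₁ u)

  classH : Fin (n * m) → Fin l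
  classH u = partH (π₂ u)

  inner : Fin (n * m) → ℕ
  inner u = LH.rank (π₂ u) + LG.rank (π₁ u) * LH.size (classH u)

  inner<size*size : ∀ u → inner u < LG.size (classG u) * LH.size (classH u)
  inner<size*size u = begin-strict
    LH.rank (π₂ u) + LG.rank (π₁ u) * LH.size (classH u) <⟨ +-monoˡ-< _ (LH.rank<size _) ⟩
    suc (LG.rank (π₁ u)) * LH.size (classH u)            ≤⟨ *-monoˡ-≤ _ (LG.rank<size _) ⟩
    LG.size (classG u) * LH.size (classH u)              ∎
    where open ≤-Reasoning

  sizeG≤a : ∀ i → LG.size i ≤ a
  sizeG≤a i = αG≤a _ (class-independent G partG G-multipartite i)

  sizeH≤b : ∀ j → LH.size j ≤ b
  sizeH≤b j = αH≤b _ (class-independent H partH H-multipartite j)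

  inner<a*size : ∀ u → inner u < a * LH.size (classH u)
  inner<a*size u = <-≤-trans (inner<size*size u) (*-monoˡ-≤ _ (sizeG≤a (classG u)))

  inner<b*size : ∀ u → inner u < b * LG.size (classG u)
  inner<b*size u = <-≤-trans (inner<size*size u) (begin
    LG.size (classG u) * LH.size (classH u) ≤⟨ *-monoʳ-≤ (LG.size (classG u)) (sizeH≤b (classH u)) ⟩
    LG.size (classG u) * b                  ≡⟨ *-comm _ b ⟩
    b * LG.size (classG u)                  ∎)
    where open ≤-Reasoning

  inner-injective : ∀ {u v} → classG u ≡ classG v → classH u ≡ classH v → inner u ≡ inner v → u ≡ v
  inner-injective {u} {v} g≡ h≡ inner≡ =
    fstV-sndV-injective {n} m (LG.rank-injective g≡ (proj₂ ranks≡)) (LH.rank-injective h≡ (proj₁ ranks≡))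
    where
    size≡ : LH.size (classH u) ≡ LH.size (classH v)
    size≡ = cong LH.size h≡
    ranks≡ : LH.rank (π₂ u) ≡ LH.rank (π₂ v) × LG.rank (π₁ u) ≡ LG.rank (π₁ v)
    ranks≡ = +-*-unique (LG.rank (π₁ u)) (LG.rank (π₁ v))
               (LH.rank<size _) (subst (_ <_) (sym size≡) (LH.rank<size _))
               (trans inner≡ (cong (λ s → LH.rank (π₂ v) + LG.rank (π₁ v) * s) (sym size≡)))

  shiftG shiftH : Fin (n * m) → ℕ
  shiftG u = b * LG.offset (classG u)
  shiftH u = a * LH.offset (classH u)

  value : Fin (n * m) → ℕ
  value u = shiftG u + (shiftH u + inner u)

  shiftH+inner<D : ∀ u → shiftH u + inner u < D
  shiftH+inner<D u = <-≤-trans (LH.block<n a {classH u} (inner<a*size u)) (m≤m⊔n (a * m) (b * n))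

  shiftG+inner<D : ∀ u → shiftG u + inner u < D
  shiftG+inner<D u = <-≤-trans (LG.block<n b {classG u} (inner<b*size u)) (m≤n⊔m (a * m) (b * n))

  module _ {u v} .{{_ : NonZero D}} (same : value u % D ≡ value v % D) where

    sameColour-sameClassG : classG u ≡ classG v → u ≡ v
    sameColour-sameClassG g≡ = inner-injective g≡ h≡ inner≡
      where
      w≡ : shiftH u + inner u ≡ shiftH v + inner v
      w≡ = +-cancelˡ-% (shiftG u) (shiftH+inner<D u) (shiftH+inner<D v)
             (trans same (cong (λ i → (b * LG.offset i + (shiftH v + inner v)) % D) (sym g≡)))
      h≡ : classH u ≡ classH v
      h≡ = LH.block-injective a {classH u} {classH v} (inner<a*size u) (inner<a*size v) w≡
      inner≡ : inner u ≡ inner v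
      inner≡ = +-cancelˡ-≡ (shiftH u) _ _ (trans w≡ (cong (λ j → a * LH.offset j + inner v) (sym h≡)))

    sameColour-sameClassH : classH u ≡ classH v → u ≡ v
    sameColour-sameClassH h≡ = inner-injective g≡ h≡ inner≡
      where
      open ≡-Reasoning
      w≡ : shiftG u + inner u ≡ shiftG v + inner v
      w≡ = +-cancelˡ-% (shiftH u) (shiftG+inner<D u) (shiftG+inner<D v) (begin
        (shiftH u + (shiftG u + inner u)) % D ≡⟨ cong (_% D) (x∙yz≈y∙xz (shiftG u) (shiftH u) (inner u)) ⟨
        value u % D                           ≡⟨ same ⟩
        value v % D                           ≡⟨ cong (_% D) (x∙yz≈y∙xz (shiftG v) (shiftH v) (inner v)) ⟩
        (shiftH v + (shiftG v + inner v)) % D ≡⟨ cong (λ j → (a * LH.offset j + (shiftG v + inner v)) % D) (sym h≡) ⟩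
        (shiftH u + (shiftG v + inner v)) % D ∎)
      g≡ : classG u ≡ classG v
      g≡ = LG.block-injective b {classG u} {classG v} (inner<b*size u) (inner<b*size v) w≡
      inner≡ : inner u ≡ inner v
      inner≡ = +-cancelˡ-≡ (shiftG u) _ _ (trans w≡ (cong (λ i → b * LG.offset i + inner v) (sym g≡)))

  -- D is 0 only if G × H has no vertex, so a vertex supplies the NonZero instance needed for _%_.
  D-nonZero : Fin (n * m) → NonZero D
  D-nonZero u = >-nonZero (≤-<-trans z≤n (shiftH+inner<D u))

  colour : Fin (n * m) → Fin D
  colour u = fromℕ< (m%n<n (value u) D {{D-nonZero u}})

  open Layout colour using () renaming (class to colourClass; ∈-class⁺ to ∈-colourClass⁺; ∈-class⁻ to ∈-colourClass⁻)

  colourClass-clique : ∀ i → IsClique (G ⊗ H) (colourClass i)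
  colourClass-clique i u v u∈ v∈ u≢v =
    Equivalence.from (G-multipartite _ _) (u≢v ∘ sameColour-sameClassG same) ,
    Equivalence.from (H-multipartite _ _) (u≢v ∘ sameColour-sameClassH same)
    where
    instance
      _ : NonZero D
      _ = D-nonZero u
    same : value u % D ≡ value v % D
    same = begin
      value u % D    ≡⟨ Finₚ.toℕ-fromℕ< _ ⟨
      toℕ (colour u) ≡⟨ cong toℕ (trans (∈-colourClass⁻ i u∈) (sym (∈-colourClass⁻ i v∈))) ⟩
      toℕ (colour v) ≡⟨ Finₚ.toℕ-fromℕ< _ ⟩
      value v % D    ∎
      where open ≡-Reasoning

  cliqueCover : CliqueCover (G ⊗ H) D
  cliqueCover = colourClass , colourClass-clique , λ u → colour u , ∈-colourClass⁺ u

lemma3 : ∀ {n m} (G : Graph n) (H : Graph m) →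
         IsCompleteMultipartite G → IsCompleteMultipartite H →
         ∀ (a b : ℕ) → IsIndependenceNumber G a → IsIndependenceNumber H b →
         IsIndependenceNumber (G ⊗ H) ((a * m) ⊔ (b * n)) ×
         IsCliqueCoverNumber (G ⊗ H) ((a * m) ⊔ (b * n))
lemma3 G H (_ , partG , G-multipartite) (_ , partH , H-multipartite) a b αG αH =
  independent+cliqueCover⇒numbers (G ⊗ H) (⊗-independent-⊔ G H αG αH)
    (⊗-CliqueCover.cliqueCover G H partG G-multipartite partH H-multipartite (proj₂ αG) (proj₂ αH))
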